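{- Let $N$ be a primitive non-deficient number, and write $N = p_1^{a_1} p_2^{a_2} \cdots p_k^{a_k}$ with $p_1, \dots, p_k$ distinct primes and $a_i \ge 1$; let $R = p_1 p_2 \cdots p_k$. Suppose that $a_j \ge 2$ for some $j$ with $1 \le j \le k$. Then $$\sum_{i=1}^k \left( \frac{1}{p_i^{a_i+1}} + \left(\frac{1}{p_i^{a_i+1}}\right)^2 \right) \ge \frac{1}{R} - \frac{1}{2R^2} - \frac{2}{p_j^{a_j} - 1}.$$
   Context: $\sigma(n)$ is the sum of the positive divisors of $n$. A positive integer $n$ is deficient if $\sigma(n) < 2n$; $n$ is primitive non-deficient if $\sigma(n) \ge 2n$ and every proper divisor of $n$ is deficient. -}

module Defs where

open import Data.Nat using (ℕ; zero; suc; _+_; _*_; _∸_; _^_; _≤_; _<_; _≥_)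
open import Data.Nat.Divisibility using (_∣_; _∣?_)
open import Data.Nat.Primality using (Prime)
open import Data.List using (List; []; _∷_; filter; upTo; map; length)
open import Data.Nat.ListAction using (sum; product)
open import Data.List.Relation.Unary.All using (All)
open import Data.List.Relation.Unary.AllPairs using (AllPairs)
open import Data.Product using (_×_; _,_; proj₁; proj₂)
open import Data.Integer using (+_)
open import Data.Rational using (ℚ; _/_; 0ℚ)
import Data.Rational as ℚ
open import Relation.Binary.PropositionalEquality using (_≡_; _≢_)

divisors : ℕ → List ℕ
divisors n = filter (_∣? n) (map suc (upTo n))

σ : ℕ → ℕ
σ n = sum (divisors n)

Deficient : ℕ → Set
Deficient n = σ n < 2 * n

PrimitiveNonDeficient : ℕ → Set
PrimitiveNonDeficient n =
  1 ≤ n × σ n ≥ 2 * n × (∀ d → d ∣ n → d < n → 1 ≤ d → Deficient d)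

IsFactorization : ℕ → List (ℕ × ℕ) → Set
IsFactorization N fs =
  All (λ pa → Prime (proj₁ pa) × 1 ≤ proj₂ pa) fs ×
  AllPairs (λ x y → proj₁ x ≢ proj₁ y) fs ×
  product (map (λ pa → proj₁ pa ^ proj₂ pa) fs) ≡ N

-- reciprocal 1/n as a rational; convention inv 0 = 0 (never used at 0 in
-- the theorem, since all arguments there are ≥ 2)
inv : ℕ → ℚ
inv zero = 0ℚ
inv (suc n) = + 1 / suc n

radical : List (ℕ × ℕ) → ℕ
radical fs = product (map proj₁ fs)

lhsSum : List (ℕ × ℕ) → ℚ
lhsSum [] = 0ℚ
lhsSum ((p , a) ∷ fs) =
  (inv (p ^ (a + 1)) ℚ.+ inv (p ^ (a + 1)) ℚ.* inv (p ^ (a + 1))) ℚ.+ lhsSum fs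

module Submission where

-- Let N = ∏ pᵢ^aᵢ be primitive non-deficient, R = ∏ pᵢ its radical, qᵢ = pᵢ^(aᵢ+1),
-- and fix j with aⱼ ≥ 1 (the theorem assumes aⱼ ≥ 2); put A = pⱼ^aⱼ and α = A − 1.
-- We prove the stronger bound
--     1/R ≤ Σ 1/qᵢ + 1/α,                                                      (⋆)
-- from which the theorem follows by dropping 1/(2R²) ≥ 0, one 1/α ≥ 0 and 1/qᵢ² ≥ 0.
-- Write Q = ∏ qᵢ = N·R, U = ∏ (qᵢ − 1), φ = ∏ (pᵢ − 1) and W for the numerator
-- with W/Q = Σ 1/qᵢ.  Then, working in ℕ (module NaturalArithmetic):
--  1. σ(N) = ∏ (1 + pᵢ + ⋯ + pᵢ^aᵢ), via an explicit duplicate-free list of divisors;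
--     hence φ·σ(N) = U and, for the proper divisor M = N/pⱼ, U·α = (pⱼA − 1)·φ·σ(M).
--  2. Abundance σ(N) ≥ 2N with U < Q = N·R gives 2φ < R; then deficiency
--     σ(M) < 2M gives U·α ≤ A·N·(R − 1).
--  3. The Weierstrass inequality ∏ (1 − 1/qᵢ) ≥ 1 − Σ 1/qᵢ, i.e. Q ≤ W + U, turns
--     this into Q·α ≤ (W·α + Q)·R, which is (⋆) with denominators cleared.
-- Finally (⋆) is read back in ℚ, using Σ 1/qᵢ ≤ Σ (1/qᵢ + 1/qᵢ²).

module NaturalArithmetic where

  open import Defs
  open import Data.Nat using (ℕ; zero; suc; _+_; _*_; _∸_; _^_; _≤_; _<_; z≤n; s≤s; NonZero; >-nonZero; nonTrivial⇒n>1)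
  open import Data.Nat.Properties
  open import Algebra.Properties.CommutativeSemigroup *-commutativeSemigroup using (interchange; x∙yz≈y∙xz)
  open import Data.Nat.Divisibility
  open import Data.Nat.Primality
  open import Data.Nat.Coprimality using (Coprime; coprime-divisor)
  open import Data.List using (List; []; _∷_; _++_; map; upTo; length; lookup)
  open import Data.Nat.ListAction using (sum; product)
  open import Data.Nat.ListAction.Properties using (sum-++; sum-↭)
  open import Data.List.Membership.Propositional using (_∈_)
  open import Data.List.Membership.Propositional.Properties
  open import Data.List.Membership.Propositional.Properties.WithK using (unique∧set⇒bag)
  open import Data.List.Relation.Binary.BagAndSetEquality using (∼bag⇒↭)
  open import Data.List.Relation.Unary.Any using (here)
  open import Data.List.Relation.Unary.All as All using (All; []; _∷_)
  open import Data.List.Relation.Unary.AllPairs using (AllPairs; []; _∷_)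
  open import Data.List.Relation.Unary.Unique.Propositional using (Unique)
  import Data.List.Relation.Unary.Unique.Propositional.Properties as Unique
  open import Data.Product using (_×_; _,_; proj₁; proj₂)
  open import Data.Sum using (inj₁; inj₂; [_,_]′)
  open import Data.Empty using (⊥-elim)
  open import Data.Fin using (Fin; zero; suc)
  open import Data.Fin.Properties using (toℕ<n)
  open import Function.Bundles using (mk⇔; _⇔_; Equivalence)
  open import Data.List.Relation.Binary.Permutation.Propositional using (_↭_)
  open import Relation.Nullary using (¬_; yes; no)
  open import Relation.Binary.PropositionalEquality
  open import Data.Nat.Tactic.RingSolver using (solve-∀)

  powerProduct : List (ℕ × ℕ) → ℕ
  powerProduct fs = product (map (λ pa → proj₁ pa ^ proj₂ pa) fs)

  Primes : List (ℕ × ℕ) → Set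
  Primes fs = All (λ pa → Prime (proj₁ pa)) fs

  DistinctPrimes : List (ℕ × ℕ) → Set
  DistinctPrimes fs = AllPairs (λ x y → proj₁ x ≢ proj₁ y) fs

  ¬prime∣1 : ∀ {p} → Prime p → ¬ p ∣ 1
  ¬prime∣1 pp p∣1 = ¬prime[1] (subst Prime (∣1⇒≡1 p∣1) pp)

  prime∣prime⇒≡ : ∀ {p q} → Prime p → Prime q → p ∣ q → p ≡ q
  prime∣prime⇒≡ pp pq p∣q with prime⇒irreducible pq p∣q
  ... | inj₁ p≡1 = ⊥-elim (¬prime[1] (subst Prime p≡1 pp))
  ... | inj₂ p≡q = p≡q

  prime∣^⇒∣ : ∀ {p q} → Prime p → ∀ b → p ∣ q ^ b → p ∣ q
  prime∣^⇒∣ pp zero p∣1 = ⊥-elim (¬prime∣1 pp p∣1)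
  prime∣^⇒∣ {q = q} pp (suc b) p∣q^b+1 =
    [ (λ p∣q → p∣q) , prime∣^⇒∣ pp b ]′ (euclidsLemma q (q ^ b) pp p∣q^b+1)

  ∤prime⇒coprime : ∀ {p d} → Prime p → ¬ p ∣ d → Coprime d p
  ∤prime⇒coprime pp p∤d (i∣d , i∣p) with prime⇒irreducible pp i∣p
  ... | inj₁ i≡1 = i≡1
  ... | inj₂ refl = ⊥-elim (p∤d i∣d)

  prime∤powerProduct : ∀ {p} → Prime p → ∀ fs → Primes fs →
    All (λ qb → p ≢ proj₁ qb) fs → ¬ p ∣ powerProduct fs
  prime∤powerProduct pp [] [] [] = ¬prime∣1 pp
  prime∤powerProduct pp ((q , b) ∷ r) (pq ∷ ps) (p≢q ∷ p≢r) p∣ =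
    [ (λ p∣q^b → p≢q (prime∣prime⇒≡ pp pq (prime∣^⇒∣ pp b p∣q^b)))
    , prime∤powerProduct pp r ps p≢r ]′ (euclidsLemma (q ^ b) (powerProduct r) pp p∣)

  geomSum : ℕ → ℕ → ℕ
  geomSum p zero = 1
  geomSum p (suc a) = 1 + p * geomSum p a

  -- The closed form (p − 1)(1 + p + ⋯ + p^a) = p^(a+1) − 1 (valid also for p = 0 in ℕ).
  geomSum-closed : ∀ p a → (p ∸ 1) * geomSum p a ≡ p ^ suc a ∸ 1
  geomSum-closed zero a = refl
  geomSum-closed (suc q) a = trans (sym (m+n∸n≡m (q * geomSum (suc q) a) 1)) (cong (_∸ 1) (telescope a))
    where
    telescope : ∀ a → q * geomSum (suc q) a + 1 ≡ suc q ^ suc a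
    telescope zero = +-comm (q * 1) 1
    telescope (suc a) = trans (shift q (geomSum (suc q) a)) (cong (suc q *_) (telescope a))
      where
      shift : ∀ q s → q * (1 + suc q * s) + 1 ≡ suc q * (q * s + 1)
      shift = solve-∀

  -- powerMultiples p a ds lists ds, p·ds, …, p^a·ds; applied once per prime
  -- power it builds the list of all divisors of a factorized number.
  powerMultiples : ℕ → ℕ → List ℕ → List ℕ
  powerMultiples p zero ds = ds
  powerMultiples p (suc a) ds = ds ++ map (p *_) (powerMultiples p a ds)

  divisorList : List (ℕ × ℕ) → List ℕ
  divisorList [] = 1 ∷ []
  divisorList ((p , a) ∷ r) = powerMultiples p a (divisorList r)

  divisorSum : List (ℕ × ℕ) → ℕ
  divisorSum [] = 1
  divisorSum ((p , a) ∷ r) = geomSum p a * divisorSum r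

  sum-map-* : ∀ p ds → sum (map (p *_) ds) ≡ p * sum ds
  sum-map-* p [] = sym (*-zeroʳ p)
  sum-map-* p (d ∷ ds) = trans (cong (p * d +_) (sum-map-* p ds)) (sym (*-distribˡ-+ p d (sum ds)))

  sum-powerMultiples : ∀ p a ds → sum (powerMultiples p a ds) ≡ geomSum p a * sum ds
  sum-powerMultiples p zero ds = sym (+-identityʳ (sum ds))
  sum-powerMultiples p (suc a) ds = begin
    sum (ds ++ map (p *_) (powerMultiples p a ds))  ≡⟨ sum-++ ds _ ⟩
    sum ds + sum (map (p *_) (powerMultiples p a ds)) ≡⟨ cong (sum ds +_) (sum-map-* p (powerMultiples p a ds)) ⟩
    sum ds + p * sum (powerMultiples p a ds)         ≡⟨ cong (λ s → sum ds + p * s) (sum-powerMultiples p a ds) ⟩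
    sum ds + p * (geomSum p a * sum ds)              ≡⟨ factor (sum ds) p (geomSum p a) ⟩
    (1 + p * geomSum p a) * sum ds                   ∎
    where
    open ≡-Reasoning
    factor : ∀ s p g → s + p * (g * s) ≡ (1 + p * g) * s
    factor = solve-∀

  sum-divisorList : ∀ fs → sum (divisorList fs) ≡ divisorSum fs
  sum-divisorList [] = refl
  sum-divisorList ((p , a) ∷ r) =
    trans (sum-powerMultiples p a (divisorList r)) (cong (geomSum p a *_) (sum-divisorList r))

  powerMultiples-∣ : ∀ p a ds m → (∀ {d} → d ∈ ds → d ∣ m) →
    ∀ {x} → x ∈ powerMultiples p a ds → x ∣ p ^ a * m
  powerMultiples-∣ p zero ds m ds∣m x∈ = subst (_ ∣_) (sym (*-identityˡ m)) (ds∣m x∈)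
  powerMultiples-∣ p (suc a) ds m ds∣m x∈ with ∈-++⁻ ds x∈
  ... | inj₁ x∈ds = ∣n⇒∣m*n (p * p ^ a) (ds∣m x∈ds)
  ... | inj₂ x∈pds with ∈-map⁻ (p *_) x∈pds
  ...   | y , y∈ , refl =
    subst (p * y ∣_) (sym (*-assoc p (p ^ a) m)) (*-monoʳ-∣ p (powerMultiples-∣ p a ds m ds∣m y∈))

  divisorList-∣ : ∀ fs {x} → x ∈ divisorList fs → x ∣ powerProduct fs
  divisorList-∣ [] (here refl) = ∣-refl
  divisorList-∣ ((p , a) ∷ r) = powerMultiples-∣ p a (divisorList r) (powerProduct r) (divisorList-∣ r)

  coprime-∣^* : ∀ {d p m} → Coprime d p → ∀ a → d ∣ p ^ a * m → d ∣ m
  coprime-∣^* {m = m} d⊥p zero d∣ = subst (_ ∣_) (*-identityˡ m) d∣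
  coprime-∣^* {d} {p} {m} d⊥p (suc a) d∣ =
    coprime-∣^* d⊥p a (coprime-divisor d⊥p (subst (d ∣_) (*-assoc p (p ^ a) m) d∣))

  ∣⇒∈powerMultiples : ∀ {p} → Prime p → ∀ a ds m → ¬ p ∣ m → (∀ {d} → d ∣ m → d ∈ ds) →
    ∀ {d} → d ∣ p ^ a * m → d ∈ powerMultiples p a ds
  ∣⇒∈powerMultiples pp zero ds m p∤m ∣⇒∈ds d∣ = ∣⇒∈ds (subst (_ ∣_) (*-identityˡ m) d∣)
  ∣⇒∈powerMultiples {p} pp (suc a) ds m p∤m ∣⇒∈ds {d} d∣ with p ∣? d
  ... | no p∤d = ∈-++⁺ˡ (∣⇒∈ds (coprime-∣^* (∤prime⇒coprime pp p∤d) (suc a) d∣))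
  ... | yes (divides e refl) = ∈-++⁺ʳ ds (subst (_∈ map (p *_) (powerMultiples p a ds)) (*-comm p e)
          (∈-map⁺ (p *_) (∣⇒∈powerMultiples pp a ds m p∤m ∣⇒∈ds e∣)))
    where
    instance _ = prime⇒nonZero pp
    e∣ : e ∣ p ^ a * m
    e∣ = *-cancelˡ-∣ p (subst₂ _∣_ (*-comm e p) (*-assoc p (p ^ a) m) d∣)

  ∣⇒∈divisorList : ∀ fs → Primes fs → DistinctPrimes fs → ∀ {d} → d ∣ powerProduct fs → d ∈ divisorList fs
  ∣⇒∈divisorList [] [] [] d∣1 = here (∣1⇒≡1 d∣1)
  ∣⇒∈divisorList ((p , a) ∷ r) (pp ∷ ps) (p∉r ∷ dr) =
    ∣⇒∈powerMultiples pp a (divisorList r) (powerProduct r)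
      (prime∤powerProduct pp r ps p∉r) (∣⇒∈divisorList r ps dr)

  powerMultiples-unique : ∀ p .{{_ : NonZero p}} a ds → Unique ds → (∀ {d} → d ∈ ds → ¬ p ∣ d) →
    Unique (powerMultiples p a ds)
  powerMultiples-unique p zero ds u p∤ds = u
  powerMultiples-unique p (suc a) ds u p∤ds =
    Unique.++⁺ u (Unique.map⁺ (*-cancelˡ-≡ _ _ p) (powerMultiples-unique p a ds u p∤ds)) disjoint
    where
    disjoint : ∀ {v} → v ∈ ds × v ∈ map (p *_) (powerMultiples p a ds) → _
    disjoint (v∈ds , v∈pds) with ∈-map⁻ (p *_) v∈pds
    ... | e , _ , refl = p∤ds v∈ds (m∣m*n e)

  -- divisorList has no repetitions: the primes of the tail do not divide its members.
  divisorList-unique : ∀ fs → Primes fs → DistinctPrimes fs → Unique (divisorList fs)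
  divisorList-unique [] [] [] = [] ∷ []
  divisorList-unique ((p , a) ∷ r) (pp ∷ ps) (p∉r ∷ dr) =
    powerMultiples-unique p {{prime⇒nonZero pp}} a (divisorList r) (divisorList-unique r ps dr)
      (λ d∈ p∣d → prime∤powerProduct pp r ps p∉r (∣-trans p∣d (divisorList-∣ r d∈)))

  ∈divisors⇔∣ : ∀ {n d} → 1 ≤ n → d ∈ divisors n ⇔ d ∣ n
  ∈divisors⇔∣ {n} n≥1 = mk⇔ (λ d∈ → proj₂ (∈-filter⁻ (_∣? n) {xs = map suc (upTo n)} d∈)) (∣⇒∈divisors n≥1)
    where
    ∣⇒∈divisors : ∀ {n d} → 1 ≤ n → d ∣ n → d ∈ divisors n
    ∣⇒∈divisors {suc n} {zero} _ 0∣n with () ← 0∣⇒≡0 0∣n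
    ∣⇒∈divisors {suc n} {suc d} _ d∣n = ∈-filter⁺ (_∣? suc n) (∈-map⁺ suc (∈-upTo⁺ (∣⇒≤ d∣n))) d∣n

  divisors-unique : ∀ n → Unique (divisors n)
  divisors-unique n = Unique.filter⁺ (_∣? n) (Unique.map⁺ suc-injective (Unique.upTo⁺ n))

  powerProduct-positive : ∀ fs → Primes fs → 1 ≤ powerProduct fs
  powerProduct-positive [] [] = ≤-refl
  powerProduct-positive ((p , a) ∷ r) (pp ∷ ps) =
    *-mono-≤ (m^n>0 p {{prime⇒nonZero pp}} a) (powerProduct-positive r ps)

  -- The divisors of the product and the
  -- constructed divisorList are duplicate-free lists with the same members,
  -- hence permutations of each other with the same sum.
  σ-powerProduct : ∀ fs → Primes fs → DistinctPrimes fs → σ (powerProduct fs) ≡ divisorSum fs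
  σ-powerProduct fs ps dp = trans (sum-↭ same-divisors) (sum-divisorList fs)
    where
    n≥1 = powerProduct-positive fs ps
    same-divisors : divisors (powerProduct fs) ↭ divisorList fs
    same-divisors = ∼bag⇒↭ (unique∧set⇒bag (divisors-unique (powerProduct fs)) (divisorList-unique fs ps dp)
      (λ {d} → mk⇔ (λ d∈ → ∣⇒∈divisorList fs ps dp (Equivalence.to (∈divisors⇔∣ n≥1) d∈))
                   (λ d∈ → Equivalence.from (∈divisors⇔∣ n≥1) (divisorList-∣ fs d∈))))

  -- Writing qᵢ = pᵢ^(aᵢ+1) for the entries (pᵢ , aᵢ) of a factorization:
  -- qProduct = ∏ qᵢ, qPredProduct = ∏ (qᵢ − 1), radicalTotient = ∏ (pᵢ − 1),
  -- and qReciprocalNumerator is the numerator W with W / qProduct = Σ 1/qᵢ.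
  qProduct : List (ℕ × ℕ) → ℕ
  qProduct [] = 1
  qProduct ((p , a) ∷ r) = p ^ suc a * qProduct r

  qPredProduct : List (ℕ × ℕ) → ℕ
  qPredProduct [] = 1
  qPredProduct ((p , a) ∷ r) = (p ^ suc a ∸ 1) * qPredProduct r

  radicalTotient : List (ℕ × ℕ) → ℕ
  radicalTotient [] = 1
  radicalTotient ((p , a) ∷ r) = (p ∸ 1) * radicalTotient r

  qReciprocalNumerator : List (ℕ × ℕ) → ℕ
  qReciprocalNumerator [] = 0
  qReciprocalNumerator ((p , a) ∷ r) = qProduct r + p ^ suc a * qReciprocalNumerator r

  radicalTotient-divisorSum : ∀ fs → radicalTotient fs * divisorSum fs ≡ qPredProduct fs
  radicalTotient-divisorSum [] = refl
  radicalTotient-divisorSum ((p , a) ∷ r) = begin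
    (p ∸ 1) * radicalTotient r * (geomSum p a * divisorSum r)   ≡⟨ interchange (p ∸ 1) _ _ _ ⟩
    (p ∸ 1) * geomSum p a * (radicalTotient r * divisorSum r)
      ≡⟨ cong₂ _*_ (geomSum-closed p a) (radicalTotient-divisorSum r) ⟩
    (p ^ suc a ∸ 1) * qPredProduct r                            ∎
    where open ≡-Reasoning

  qProduct≡powerProduct*radical : ∀ fs → qProduct fs ≡ powerProduct fs * radical fs
  qProduct≡powerProduct*radical [] = refl
  qProduct≡powerProduct*radical ((p , a) ∷ r) =
    trans (cong (p * p ^ a *_) (qProduct≡powerProduct*radical r)) (regroup p (p ^ a) (powerProduct r) (radical r))
    where
    regroup : ∀ x y z w → x * y * (z * w) ≡ y * z * (x * w)
    regroup = solve-∀

  -- Weierstrass product inequality ∏ (1 − 1/qᵢ) ≥ 1 − Σ 1/qᵢ, cleared of denominators.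
  qProduct≤qReciprocalNumerator+qPredProduct : ∀ fs → qProduct fs ≤ qReciprocalNumerator fs + qPredProduct fs
  qProduct≤qReciprocalNumerator+qPredProduct [] = ≤-refl
  qProduct≤qReciprocalNumerator+qPredProduct ((p , a) ∷ r) with p ^ suc a
  ... | zero = z≤n
  ... | suc s = begin
    Q + s * Q                  ≤⟨ +-monoʳ-≤ Q (*-monoʳ-≤ s (qProduct≤qReciprocalNumerator+qPredProduct r)) ⟩
    Q + s * (W + U)            ≡⟨ expand Q s W U ⟩
    Q + s * W + s * U          ≤⟨ +-monoˡ-≤ (s * U) (+-monoʳ-≤ Q (m≤n+m (s * W) W)) ⟩
    Q + (W + s * W) + s * U    ∎
    where
    open ≤-Reasoning
    Q = qProduct r
    W = qReciprocalNumerator r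
    U = qPredProduct r
    expand : ∀ t s w u → t + s * (w + u) ≡ t + s * w + s * u
    expand = solve-∀

  qProduct-positive : ∀ fs → Primes fs → 1 ≤ qProduct fs
  qProduct-positive [] [] = ≤-refl
  qProduct-positive ((p , a) ∷ r) (pp ∷ ps) =
    *-mono-≤ (m^n>0 p {{prime⇒nonZero pp}} (suc a)) (qProduct-positive r ps)

  qPredProduct≤qProduct : ∀ fs → qPredProduct fs ≤ qProduct fs
  qPredProduct≤qProduct [] = ≤-refl
  qPredProduct≤qProduct ((p , a) ∷ r) = *-mono-≤ (m∸n≤m (p ^ suc a) 1) (qPredProduct≤qProduct r)

  qPredProduct<qProduct : ∀ fs → Primes fs → 0 < length fs → qPredProduct fs < qProduct fs
  qPredProduct<qProduct ((p , a) ∷ r) (pp ∷ ps) _ with p ^ suc a | m^n>0 p {{prime⇒nonZero pp}} (suc a)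
  ... | suc t | _ = begin-strict
    t * qPredProduct r          ≤⟨ *-monoʳ-≤ t (qPredProduct≤qProduct r) ⟩
    t * qProduct r              <⟨ m<n+m (t * qProduct r) (qProduct-positive r ps) ⟩
    qProduct r + t * qProduct r ∎
    where open ≤-Reasoning

  lowerAt : (fs : List (ℕ × ℕ)) → Fin (length fs) → List (ℕ × ℕ)
  lowerAt ((p , a) ∷ r) zero = (p , a ∸ 1) ∷ r
  lowerAt (x ∷ r) (suc j) = x ∷ lowerAt r j

  lowerAt-bases : ∀ {P : ℕ → Set} fs j →
    All (λ pa → P (proj₁ pa)) fs → All (λ pa → P (proj₁ pa)) (lowerAt fs j)
  lowerAt-bases ((p , a) ∷ r) zero (h ∷ hs) = h ∷ hs
  lowerAt-bases (x ∷ r) (suc j) (h ∷ hs) = h ∷ lowerAt-bases r j hs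

  lowerAt-distinct : ∀ fs j → DistinctPrimes fs → DistinctPrimes (lowerAt fs j)
  lowerAt-distinct ((p , a) ∷ r) zero (h ∷ hs) = h ∷ hs
  lowerAt-distinct (x ∷ r) (suc j) (h ∷ hs) = lowerAt-bases r j h ∷ lowerAt-distinct r j hs

  powerProduct-lowerAt : ∀ fs j → 1 ≤ proj₂ (lookup fs j) →
    powerProduct fs ≡ proj₁ (lookup fs j) * powerProduct (lowerAt fs j)
  powerProduct-lowerAt ((p , suc a) ∷ r) zero _ = *-assoc p (p ^ a) (powerProduct r)
  powerProduct-lowerAt ((p , a) ∷ r) (suc j) a≥1 =
    trans (cong (p ^ a *_) (powerProduct-lowerAt r j a≥1))
          (x∙yz≈y∙xz (p ^ a) (proj₁ (lookup r j)) (powerProduct (lowerAt r j)))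

  lowerAt-deficient : ∀ fs j → Primes fs → 1 ≤ proj₂ (lookup fs j) →
    (∀ d → d ∣ powerProduct fs → d < powerProduct fs → 1 ≤ d → Deficient d) →
    Deficient (powerProduct (lowerAt fs j))
  lowerAt-deficient fs j ps a≥1 properDivisorsDeficient =
    properDivisorsDeficient M (divides p N≡pM) (subst (M <_) (trans (*-comm M p) (sym N≡pM)) M<M*p) M≥1
    where
    p = proj₁ (lookup fs j)
    M = powerProduct (lowerAt fs j)
    N≡pM = powerProduct-lowerAt fs j a≥1
    M≥1 = powerProduct-positive (lowerAt fs j) (lowerAt-bases fs j ps)
    p>1 = nonTrivial⇒n>1 p {{prime⇒nonTrivial (All.lookup ps (∈-lookup j))}}
    M<M*p = m<m*n M p {{>-nonZero M≥1}} p>1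

  primePower-pred-positive : ∀ {p} a → Prime p → 1 ≤ a → 1 ≤ p ^ a ∸ 1
  primePower-pred-positive {p} a pp a≥1 = ∸-monoˡ-≤ 1 (≤-trans p>1 p≤p^a)
    where
    p>1 = nonTrivial⇒n>1 p {{prime⇒nonTrivial pp}}
    p≤p^a = subst (_≤ p ^ a) (*-identityʳ p) (^-monoʳ-≤ p {{prime⇒nonZero pp}} a≥1)

  divisorSum-lowerAt : ∀ fs j →
    divisorSum fs * geomSum (proj₁ (lookup fs j)) (proj₂ (lookup fs j) ∸ 1)
      ≡ geomSum (proj₁ (lookup fs j)) (proj₂ (lookup fs j)) * divisorSum (lowerAt fs j)
  divisorSum-lowerAt ((p , a) ∷ r) zero =
    trans (*-assoc (geomSum p a) _ _) (cong (geomSum p a *_) (*-comm (divisorSum r) _))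
  divisorSum-lowerAt ((p , a) ∷ r) (suc j) = begin
    geomSum p a * divisorSum r * geomSum q (b ∸ 1)        ≡⟨ *-assoc (geomSum p a) _ _ ⟩
    geomSum p a * (divisorSum r * geomSum q (b ∸ 1))      ≡⟨ cong (geomSum p a *_) (divisorSum-lowerAt r j) ⟩
    geomSum p a * (geomSum q b * divisorSum (lowerAt r j)) ≡⟨ x∙yz≈y∙xz (geomSum p a) (geomSum q b) _ ⟩
    geomSum q b * (geomSum p a * divisorSum (lowerAt r j)) ∎
    where
    open ≡-Reasoning
    q = proj₁ (lookup r j)
    b = proj₂ (lookup r j)

  qPredProduct-lowerAt : ∀ fs j → 1 ≤ proj₂ (lookup fs j) →
    qPredProduct fs * (proj₁ (lookup fs j) ^ proj₂ (lookup fs j) ∸ 1)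
      ≡ (proj₁ (lookup fs j) ^ suc (proj₂ (lookup fs j)) ∸ 1) * (radicalTotient fs * divisorSum (lowerAt fs j))
  qPredProduct-lowerAt fs j a≥1 = begin
    qPredProduct fs * (p ^ a ∸ 1)                     ≡⟨ cong₂ _*_ (sym (radicalTotient-divisorSum fs)) α≡ ⟩
    radicalTotient fs * divisorSum fs * ((p ∸ 1) * g′) ≡⟨ interchange (radicalTotient fs) _ _ _ ⟩
    radicalTotient fs * (p ∸ 1) * (divisorSum fs * g′) ≡⟨ cong (radicalTotient fs * (p ∸ 1) *_) (divisorSum-lowerAt fs j) ⟩
    radicalTotient fs * (p ∸ 1) * (geomSum p a * σ′)   ≡⟨ interchange (radicalTotient fs) _ _ _ ⟩
    radicalTotient fs * geomSum p a * ((p ∸ 1) * σ′)   ≡⟨ regroup (radicalTotient fs) (geomSum p a) (p ∸ 1) σ′ ⟩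
    (p ∸ 1) * geomSum p a * (radicalTotient fs * σ′)   ≡⟨ cong (_* (radicalTotient fs * σ′)) (geomSum-closed p a) ⟩
    (p ^ suc a ∸ 1) * (radicalTotient fs * σ′)         ∎
    where
    open ≡-Reasoning
    p = proj₁ (lookup fs j)
    a = proj₂ (lookup fs j)
    g′ = geomSum p (a ∸ 1)
    σ′ = divisorSum (lowerAt fs j)
    α≡ : p ^ a ∸ 1 ≡ (p ∸ 1) * g′
    α≡ = trans (cong (λ e → p ^ e ∸ 1) (sym (suc-pred a {{>-nonZero a≥1}}))) (sym (geomSum-closed p (a ∸ 1)))
    regroup : ∀ x y z w → x * y * (z * w) ≡ z * y * (x * w)
    regroup = solve-∀

  abundance⇒2totient<radical : ∀ N σN Φ U Q R → 2 * N ≤ σN → Φ * σN ≡ U → U < Q → Q ≡ N * R → 2 * Φ < R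
  abundance⇒2totient<radical N σN Φ U Q R 2N≤σN Φσ≡U U<Q Q≡NR = *-cancelˡ-< N (2 * Φ) R (begin-strict
    N * (2 * Φ)  ≡⟨ x∙yz≈y∙xz N 2 Φ ⟩
    2 * (N * Φ)  ≡⟨ cong (2 *_) (*-comm N Φ) ⟩
    2 * (Φ * N)  ≡⟨ x∙yz≈y∙xz 2 Φ N ⟩
    Φ * (2 * N)  ≤⟨ *-monoʳ-≤ Φ 2N≤σN ⟩
    Φ * σN       ≡⟨ Φσ≡U ⟩
    U            <⟨ U<Q ⟩
    Q            ≡⟨ Q≡NR ⟩
    N * R        ∎)
    where open ≤-Reasoning

  deficiency⇒bound : ∀ U α Φ σM M N p A R → U * α ≡ (p * A ∸ 1) * (Φ * σM) →
    σM < 2 * M → N ≡ p * M → 2 * Φ < R → U * α ≤ A * N * (R ∸ 1)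
  deficiency⇒bound U α Φ σM M N p A R Uα≡ σM<2M N≡pM 2Φ<R = begin
    U * α                   ≡⟨ Uα≡ ⟩
    (p * A ∸ 1) * (Φ * σM)  ≤⟨ *-monoˡ-≤ (Φ * σM) (m∸n≤m (p * A) 1) ⟩
    p * A * (Φ * σM)        ≤⟨ *-monoʳ-≤ (p * A) (*-monoʳ-≤ Φ (<⇒≤ σM<2M)) ⟩
    p * A * (Φ * (2 * M))   ≡⟨ regroup p A Φ M ⟩
    A * (p * M) * (2 * Φ)   ≡⟨ cong (λ n → A * n * (2 * Φ)) (sym N≡pM) ⟩
    A * N * (2 * Φ)         ≤⟨ *-monoʳ-≤ (A * N) (<⇒≤pred 2Φ<R) ⟩
    A * N * (R ∸ 1)         ∎
    where
    open ≤-Reasoning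
    regroup : ∀ p A Φ M → p * A * (Φ * (2 * M)) ≡ A * (p * M) * (2 * Φ)
    regroup = solve-∀

  -- The inequality 1/R ≤ W/Q + 1/α with denominators cleared, from the Weierstrass
  -- inequality Q ≤ W + U and the bound U·α ≤ (α + 1)·N·(R − 1), where Q = N·R:
  -- multiply the first by α·R, insert the second, and cancel (α + 1)·Q·(R − 1).
  cleared-inequality : ∀ Q W U α N R → Q ≤ W + U → U * α ≤ suc α * N * (R ∸ 1) → Q ≡ N * R →
    Q * α ≤ (W * α + Q) * R
  cleared-inequality Q W U α N zero _ _ Q≡N*0 rewrite Q≡N*0 | *-zeroʳ N = z≤n
  cleared-inequality Q W U α N (suc r) Q≤W+U Uα≤ Q≡NR = +-cancelʳ-≤ (suc α * Q * r) _ _ (begin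
    Q * α + suc α * Q * r                     ≤⟨ +-monoˡ-≤ (suc α * Q * r) (*-monoʳ-≤ Q (n≤1+n α)) ⟩
    Q * suc α + suc α * Q * r                 ≡⟨ expand Q α r ⟩
    Q * α * suc r + Q * suc r                 ≤⟨ +-monoˡ-≤ (Q * suc r) (*-monoˡ-≤ (suc r) (*-monoˡ-≤ α Q≤W+U)) ⟩
    (W + U) * α * suc r + Q * suc r           ≡⟨ split W U α r Q ⟩
    W * α * suc r + Q * suc r + U * α * suc r ≤⟨ +-monoʳ-≤ (W * α * suc r + Q * suc r) (*-monoˡ-≤ (suc r) Uα≤) ⟩
    W * α * suc r + Q * suc r + suc α * N * r * suc r
      ≡⟨ trans (collect W α r N Q) (cong (λ z → (W * α + Q) * suc r + suc α * z * r) (sym Q≡NR)) ⟩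
    (W * α + Q) * suc r + suc α * Q * r       ∎)
    where
    open ≤-Reasoning
    expand : ∀ Q α r → Q * suc α + suc α * Q * r ≡ Q * α * suc r + Q * suc r
    expand = solve-∀
    split : ∀ W U α r Q → (W + U) * α * suc r + Q * suc r ≡ W * α * suc r + Q * suc r + U * α * suc r
    split = solve-∀
    collect : ∀ W α r N Q →
      W * α * suc r + Q * suc r + suc α * N * r * suc r ≡ (W * α + Q) * suc r + suc α * (N * suc r) * r
    collect = solve-∀

  abundant-deficient⇒cleared : ∀ fs j → Primes fs → DistinctPrimes fs → 1 ≤ proj₂ (lookup fs j) →
    2 * powerProduct fs ≤ σ (powerProduct fs) →
    σ (powerProduct (lowerAt fs j)) < 2 * powerProduct (lowerAt fs j) →
    let α = proj₁ (lookup fs j) ^ proj₂ (lookup fs j) ∸ 1 in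
    qProduct fs * α ≤ (qReciprocalNumerator fs * α + qProduct fs) * radical fs
  abundant-deficient⇒cleared fs j ps dp a≥1 abundant deficient =
    cleared-inequality Q W U α N R (qProduct≤qReciprocalNumerator+qPredProduct fs)
      (subst (λ A → U * α ≤ A * N * (R ∸ 1)) (sym (suc-pred A {{A≢0}})) Uα≤) Q≡NR
    where
    p = proj₁ (lookup fs j)
    A = p ^ proj₂ (lookup fs j)
    α = A ∸ 1
    N = powerProduct fs
    M = powerProduct (lowerAt fs j)
    R = radical fs
    Q = qProduct fs
    W = qReciprocalNumerator fs
    U = qPredProduct fs
    Φ = radicalTotient fs
    σM = σ M
    σM≡ : σM ≡ divisorSum (lowerAt fs j)
    σM≡ = σ-powerProduct (lowerAt fs j) (lowerAt-bases fs j ps) (lowerAt-distinct fs j dp)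
    Q≡NR : Q ≡ N * R
    Q≡NR = qProduct≡powerProduct*radical fs
    A≢0 : NonZero A
    A≢0 = m^n≢0 p (proj₂ (lookup fs j)) {{prime⇒nonZero (All.lookup ps (∈-lookup j))}}
    2Φ<R : 2 * Φ < R
    2Φ<R = abundance⇒2totient<radical N (σ N) Φ U Q R abundant
      (trans (cong (Φ *_) (σ-powerProduct fs ps dp)) (radicalTotient-divisorSum fs))
      (qPredProduct<qProduct fs ps (≤-trans (s≤s z≤n) (toℕ<n j))) Q≡NR
    Uα≤ : U * α ≤ A * N * (R ∸ 1)
    Uα≤ = deficiency⇒bound U α Φ σM M N p A R
      (trans (qPredProduct-lowerAt fs j a≥1) (cong (λ s → (p * A ∸ 1) * (Φ * s)) (sym σM≡)))
      deficient (powerProduct-lowerAt fs j a≥1) 2Φ<R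

open NaturalArithmetic

open import Defs
open import Data.Nat using (ℕ; _≥_; _^_; _∸_)
import Data.Nat as ℕ
open import Data.List using (List; lookup; length)
open import Data.Fin using (Fin)
open import Data.Product using (_×_; _,_; proj₁; proj₂)
open import Data.Rational using (ℚ; _≤_; _-_; _+_)

open import Data.Nat using (zero; suc; z≤n)
import Data.Nat.Properties as ℕ
open import Data.Nat.Primality using (prime⇒nonZero; productOfPrimes≥1)
open import Data.Nat.Tactic.RingSolver using (solve-∀)
open import Data.Integer as ℤ using (+_; +≤+)
import Data.Integer.Properties as ℤ
open import Data.Rational as ℚ using (0ℚ; toℚᵘ)
import Data.Rational.Properties as ℚ
open import Data.Rational.Solver using (module +-*-Solver)
open import Data.Rational.Unnormalised as ℚᵘ using (ℚᵘ; mkℚᵘ; *≤*; *≡*)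
import Data.Rational.Unnormalised.Properties as ℚᵘ
open import Data.List using ([]; _∷_)
open import Data.List.Relation.Unary.All as All using ([]; _∷_)
import Data.List.Relation.Unary.All.Properties as All
open import Data.List.Membership.Propositional.Properties using (∈-lookup)
open import Relation.Binary.PropositionalEquality

-- The unnormalised fraction n / (k + 1); rationals of Defs are compared through toℚᵘ.
_/1+_ : ℕ → ℕ → ℚᵘ
n /1+ k = mkℚᵘ (+ n) k

toℚᵘ-inv : ∀ k → toℚᵘ (inv (suc k)) ℚᵘ.≃ 1 /1+ k
toℚᵘ-inv k = ℚ.toℚᵘ-fromℚᵘ (1 /1+ k)

inv-nonneg : ∀ n → 0ℚ ≤ inv n
inv-nonneg zero = ℚ.≤-refl
inv-nonneg (suc k) = ℚ.toℚᵘ-cancel-≤ (ℚᵘ.≤-respʳ-≃ (ℚᵘ.≃-sym (toℚᵘ-inv k)) (*≤* (+≤+ z≤n)))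

+-/1+ : ∀ a k b l → a /1+ k ℚᵘ.+ b /1+ l ℚᵘ.≃ (a ℕ.* suc l ℕ.+ b ℕ.* suc k) /1+ (suc k ℕ.* suc l ∸ 1)
+-/1+ a k b l = *≡* (cong (ℤ._* (+ (suc k ℕ.* suc l))) (sym numerator))
  where
  numerator : + (a ℕ.* suc l ℕ.+ b ℕ.* suc k) ≡ + a ℤ.* + suc l ℤ.+ + b ℤ.* + suc k
  numerator = trans (ℤ.pos-+ (a ℕ.* suc l) (b ℕ.* suc k)) (cong₂ ℤ._+_ (ℤ.pos-* a (suc l)) (ℤ.pos-* b (suc k)))

-- One summand of lhsSum: from W/Q ≤ L deduce (Q + t·W)/(t·Q) ≤ (1/t + 1/t²) + L,
-- dropping the nonnegative square.
reciprocalSum-step : ∀ t Q W L → 1 ℕ.≤ t → 1 ℕ.≤ Q → W /1+ (Q ∸ 1) ℚᵘ.≤ toℚᵘ L →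
  (Q ℕ.+ t ℕ.* W) /1+ (t ℕ.* Q ∸ 1) ℚᵘ.≤ toℚᵘ ((inv t + inv t ℚ.* inv t) + L)
reciprocalSum-step (suc t) (suc Q) W L _ _ W/Q≤L = begin
  (suc Q ℕ.+ suc t ℕ.* W) /1+ (suc t ℕ.* suc Q ∸ 1)
    ≃⟨ ℚᵘ.≃-reflexive (cong (λ n → n /1+ (suc t ℕ.* suc Q ∸ 1)) (numerator Q t W)) ⟩
  (1 ℕ.* suc Q ℕ.+ W ℕ.* suc t) /1+ (suc t ℕ.* suc Q ∸ 1)  ≃⟨ ℚᵘ.≃-sym (+-/1+ 1 t W Q) ⟩
  1 /1+ t ℚᵘ.+ W /1+ Q                                    ≤⟨ ℚᵘ.+-mono-≤ 1/t≤ W/Q≤L ⟩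
  (toℚᵘ x ℚᵘ.+ toℚᵘ (x ℚ.* x)) ℚᵘ.+ toℚᵘ L                 ≃⟨ ℚᵘ.≃-sym toℚᵘ-+ ⟩
  toℚᵘ ((x + x ℚ.* x) + L)                                ∎
  where
  open ℚᵘ.≤-Reasoning
  x = inv (suc t)
  numerator : ∀ Q t W → suc Q ℕ.+ suc t ℕ.* W ≡ 1 ℕ.* suc Q ℕ.+ W ℕ.* suc t
  numerator = solve-∀
  x-nonneg : ℚ.NonNegative x
  x-nonneg = ℚ.nonNegative (inv-nonneg (suc t))
  square-nonneg : 0ℚ ≤ x ℚ.* x
  square-nonneg = ℚ.nonNegative⁻¹ (x ℚ.* x) {{ℚ.nonNeg*nonNeg⇒nonNeg x {{x-nonneg}} x {{x-nonneg}}}}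
  1/t≤ : 1 /1+ t ℚᵘ.≤ toℚᵘ x ℚᵘ.+ toℚᵘ (x ℚ.* x)
  1/t≤ = begin
    1 /1+ t                          ≃⟨ ℚᵘ.≃-sym (ℚᵘ.+-identityʳ (1 /1+ t)) ⟩
    1 /1+ t ℚᵘ.+ ℚᵘ.0ℚᵘ              ≤⟨ ℚᵘ.+-mono-≤ (ℚᵘ.≤-reflexive (ℚᵘ.≃-sym (toℚᵘ-inv t)))
                                        (ℚ.toℚᵘ-mono-≤ square-nonneg) ⟩
    toℚᵘ x ℚᵘ.+ toℚᵘ (x ℚ.* x)       ∎
  toℚᵘ-+ : toℚᵘ ((x + x ℚ.* x) + L) ℚᵘ.≃ (toℚᵘ x ℚᵘ.+ toℚᵘ (x ℚ.* x)) ℚᵘ.+ toℚᵘ L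
  toℚᵘ-+ = ℚᵘ.≃-trans (ℚ.toℚᵘ-homo-+ (x + x ℚ.* x) L) (ℚᵘ.+-congˡ (toℚᵘ L) (ℚ.toℚᵘ-homo-+ x (x ℚ.* x)))

reciprocalSum≤lhsSum : ∀ fs → Primes fs → qReciprocalNumerator fs /1+ (qProduct fs ∸ 1) ℚᵘ.≤ toℚᵘ (lhsSum fs)
reciprocalSum≤lhsSum [] [] = ℚᵘ.≤-refl
reciprocalSum≤lhsSum ((p , a) ∷ r) (pp ∷ ps) =
  subst (λ q → W /1+ (Q ∸ 1) ℚᵘ.≤ toℚᵘ ((inv q + inv q ℚ.* inv q) + lhsSum r)) (cong (p ^_) (ℕ.+-comm 1 a))
    (reciprocalSum-step (p ^ suc a) (qProduct r) (qReciprocalNumerator r) (lhsSum r)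
      (ℕ.m^n>0 p {{prime⇒nonZero pp}} (suc a)) (qProduct-positive r ps) (reciprocalSum≤lhsSum r ps))
  where
  W = qReciprocalNumerator ((p , a) ∷ r)
  Q = qProduct ((p , a) ∷ r)

cleared⇒inv≤ : ∀ R α Q W L → 1 ℕ.≤ R → 1 ℕ.≤ α → 1 ℕ.≤ Q → Q ℕ.* α ℕ.≤ (W ℕ.* α ℕ.+ Q) ℕ.* R →
  W /1+ (Q ∸ 1) ℚᵘ.≤ toℚᵘ L → inv R ≤ L + inv α
cleared⇒inv≤ (suc r) (suc α) (suc q) W L _ _ _ cleared W/Q≤L = ℚ.toℚᵘ-cancel-≤ (begin
  toℚᵘ (inv (suc r))                                 ≃⟨ toℚᵘ-inv r ⟩
  1 /1+ r
    ≤⟨ *≤* (subst₂ ℤ._≤_ (ℤ.pos-* 1 _) (ℤ.pos-* numer (suc r)) (+≤+ cleared′)) ⟩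
  numer /1+ (suc q ℕ.* suc α ∸ 1)                    ≃⟨ ℚᵘ.≃-sym (+-/1+ W q 1 α) ⟩
  W /1+ q ℚᵘ.+ 1 /1+ α
    ≤⟨ ℚᵘ.+-mono-≤ W/Q≤L (ℚᵘ.≤-reflexive (ℚᵘ.≃-sym (toℚᵘ-inv α))) ⟩
  toℚᵘ L ℚᵘ.+ toℚᵘ (inv (suc α))                     ≃⟨ ℚᵘ.≃-sym (ℚ.toℚᵘ-homo-+ L (inv (suc α))) ⟩
  toℚᵘ (L + inv (suc α))                             ∎)
  where
  open ℚᵘ.≤-Reasoning
  numer = W ℕ.* suc α ℕ.+ 1 ℕ.* suc q
  cleared′ : 1 ℕ.* (suc q ℕ.* suc α) ℕ.≤ numer ℕ.* suc r
  cleared′ = subst₂ ℕ._≤_ (sym (ℕ.*-identityˡ _))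
    (cong (λ n → (W ℕ.* suc α ℕ.+ n) ℕ.* suc r) (sym (ℕ.*-identityˡ (suc q)))) cleared

weaken-bound : ∀ a b c L → 0ℚ ≤ b → 0ℚ ≤ c → a ≤ L + c → a - b - (c + c) ≤ L
weaken-bound a b c L b≥0 c≥0 a≤L+c = begin
  a - b - (c + c)            ≡⟨ solve 3 (λ a b c → a :- b :- (c :+ c) := (a :- c) :+ (:- (b :+ c))) refl a b c ⟩
  (a - c) + ℚ.- (b + c)      ≤⟨ ℚ.+-monoʳ-≤ (a - c) (ℚ.neg-antimono-≤ (ℚ.+-mono-≤ b≥0 c≥0)) ⟩
  (a - c) + 0ℚ               ≡⟨ ℚ.+-identityʳ (a - c) ⟩
  a - c                      ≤⟨ ℚ.+-monoˡ-≤ (ℚ.- c) a≤L+c ⟩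
  L + c - c                  ≡⟨ solve 2 (λ L c → L :+ c :- c := L) refl L c ⟩
  L                          ∎
  where
  open ℚ.≤-Reasoning
  open +-*-Solver using (solve; _:+_; _:-_; :-_; _:=_)

mainTheorem8 : (N : ℕ) → (fs : List (ℕ × ℕ)) → PrimitiveNonDeficient N →
    IsFactorization N fs → (j : Fin (length fs)) → proj₂ (lookup fs j) ≥ 2 →
    inv (radical fs) - inv (2 ℕ.* (radical fs ^ 2))
    - (inv (proj₁ (lookup fs j) ^ proj₂ (lookup fs j) ∸ 1) + inv (proj₁ (lookup fs j) ^ proj₂ (lookup fs j) ∸ 1))
    ≤ lhsSum fs
mainTheorem8 .(powerProduct fs) fs (_ , abundant , properDivisorsDeficient) (primeExponents , distinct , refl) j aⱼ≥2 =
  weaken-bound (inv R) (inv (2 ℕ.* (R ^ 2))) (inv α) (lhsSum fs) (inv-nonneg (2 ℕ.* (R ^ 2))) (inv-nonneg α)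
    (cleared⇒inv≤ R α (qProduct fs) (qReciprocalNumerator fs) (lhsSum fs)
      (productOfPrimes≥1 (All.map⁺ ps)) (primePower-pred-positive aⱼ pⱼ-prime aⱼ≥1) (qProduct-positive fs ps)
      (abundant-deficient⇒cleared fs j ps distinct aⱼ≥1 abundant
        (lowerAt-deficient fs j ps aⱼ≥1 properDivisorsDeficient))
      (reciprocalSum≤lhsSum fs ps))
  where
  R = radical fs
  aⱼ = proj₂ (lookup fs j)
  α = proj₁ (lookup fs j) ^ aⱼ ∸ 1
  ps = All.map proj₁ primeExponents
  pⱼ-prime = All.lookup ps (∈-lookup j)
  aⱼ≥1 = ℕ.≤-trans (ℕ.n≤1+n 1) aⱼ≥2
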